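{- Let $t,u$ be trees over $\Sigma$, $r:dom(t)\to dom(u)$ a bijection with $t\sim_r u$, and $p\in dom(t)$ a position with $r(p)=\epsilon$ (the root of $u$). Then for all $q\in dom(t)$ and all $0\le d<\#_t(q)$, we have $r(q.d)=r(q).(-1)$ if and only if $q.d$ is a prefix of $p$.
   Context: A tree over an alphabet $\Sigma$ is a finite partial function $t:\mathbb{N}^*\rightharpoonup\Sigma$ whose domain is prefix-closed and such that $p.i\in dom(t)$ implies $p.j\in dom(t)$ for all $0\le j<i$. Its direction alphabet is $\mathcal{D}(t)=\{ -1,0,\dots,N\}$ where $N$ is the maximal $i$ with some $p.i\in dom(t)$, and $\mathcal{D}_+(t)=\mathcal{D}(t)\setminus\{ -1\}$; by convention $(p.i).(-1)=p$. The arity of a position is $\#_t(p)=\max\{d\in\mathcal{D}_+(t)\mid p.d\in dom(t)\}+1$ (so $0\le d<\#_t(q)$ means $q.d\in dom(t)$). A sequence $p$ is a prefix of $q$ if $q=p.q'$ for some $q'\in\mathbb{N}^*$. For trees $t_1,t_2$ and a bijection $r:dom(t_1)\to dom(t_2)$, $t_1\sim_r t_2$ holds iff for all $p\in dom(t_1)$ and $d\in\mathcal{D}_+(t_1)$ with $p.d\in dom(t_1)$ there is $e\in\mathcal{D}(t_2)$ with $r(p.d)=r(p).e$. -}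

module Defs where

open import Data.Nat using (ℕ; _<_; _≤_)
open import Data.List using (List; []; _∷_; _++_; [_])
open import Data.List.Membership.Propositional using (_∈_)
open import Data.Maybe using (Maybe; just; nothing)
import Data.Maybe
open import Data.Unit using (⊤)
open import Data.Product using (Σ; ∃; ∃-syntax; _×_; _,_)
open import Data.Sum using (_⊎_)
open import Relation.Binary.PropositionalEquality using (_≡_)

-- Positions: finite sequences of naturals, p.i written  p ++ [ i ]
Pos : Set
Pos = List ℕ

Prefix : Pos → Pos → Set
Prefix p q = ∃[ q' ] q ≡ p ++ q'

record Tree (A : Set) : Set where
  field
    label        : Pos → Maybe A
  Dom : Pos → Set
  Dom p = ∃[ a ] label p ≡ just a
  field
    finite       : ∃[ L ] (∀ p → Dom p → p ∈ L)
    prefixClosed : ∀ p i → Dom (p ++ [ i ]) → Dom p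
    siblingClosed : ∀ p i j → Dom (p ++ [ i ]) → j < i → Dom (p ++ [ j ])

open Tree public

-- Directions: -1 (up) or a child index
data Dir : Set where
  up   : Dir
  down : ℕ → Dir

parent : Pos → Maybe Pos
parent [] = nothing
parent (x ∷ []) = just []
parent (x ∷ y ∷ p) = Data.Maybe.map (x ∷_) (parent (y ∷ p))

_·_ : Pos → Dir → Maybe Pos
p · down i = just (p ++ [ i ])
p · up = parent p

InDirs : {A : Set} → Tree A → Dir → Set
InDirs t up = ⊤
InDirs t (down e) = ∃[ p ] ∃[ i ] (Dom t (p ++ [ i ]) × e ≤ i)

-- r : dom(t) → dom(u) is a bijection (r given as a function on all
-- positions; only its behaviour on dom(t) matters)
IsDomBijection : {A : Set} → Tree A → Tree A → (Pos → Pos) → Set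
IsDomBijection t u r =
  (∀ p → Dom t p → Dom u (r p)) ×
  (∀ p q → Dom t p → Dom t q → r p ≡ r q → p ≡ q) ×
  (∀ q → Dom u q → ∃[ p ] (Dom t p × r p ≡ q))

Sim : {A : Set} → Tree A → Tree A → (Pos → Pos) → Set
Sim t u r = ∀ p d → Dom t (p ++ [ d ]) →
  ∃[ e ] (InDirs u e × just (r (p ++ [ d ])) ≡ r p · e)

{-# OPTIONS --safe #-}
module Submission where

-- Edges of t are sent by r to edges of u, pointing either up or down.  If q.d
-- is a prefix of p, induction along the path from p up to q.d shows the edge
-- q → q.d points up: for q.d = p this is forced by r p = ε, and otherwise a
-- downward edge would make r (q.d) a child of both r q and (by induction)
-- r (q.d.j), against injectivity.
-- Conversely, the path from p to ε and on to q is sent to a walk in u from the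
-- root to r q, and such a walk passes through every ancestor of r q.  If the
-- edge q → q.d points up, then r (q.d) is such an ancestor, so by injectivity
-- q.d lies on that path; as q.d is not a prefix of q, it is a prefix of p.

open import Defs
open import Data.Nat using (ℕ)
open import Data.List using (_++_; [_]; []; _∷_; _∷ʳ_)
open import Data.List.Properties
  using ( ++-assoc; ++-identityʳ; ++-identityʳ-unique; ++-conicalˡ; ++-conicalʳ
        ; ∷ʳ-++; ∷ʳ-injectiveˡ)
open import Data.List.Reverse using (Reverse; reverseView; []; _∶_∶ʳ_)
open import Data.Maybe using (just)
open import Data.Maybe.Properties using (just-injective)
open import Data.Product using (_×_; _,_; ∃-syntax; map₂)
open import Data.Sum using (_⊎_; inj₁; inj₂)
open import Data.Empty using (⊥-elim)
open import Function.Base using (_∘_)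
open import Function.Bundles using (_⇔_; mk⇔; Equivalence)
open import Function.Construct.Identity using (⇔-id)
open import Function.Construct.Composition using (_⇔-∘_)
open import Relation.Nullary using (¬_)
open import Relation.Binary.PropositionalEquality
  using (_≡_; refl; sym; trans; cong; subst)

open Equivalence using (to; from)

IsParent : Pos → Pos → Set
IsParent a b = ∃[ k ] b ≡ a ∷ʳ k

Adjacent : Pos → Pos → Set
Adjacent a b = IsParent a b ⊎ IsParent b a

adjacent-sym : ∀ {a b} → Adjacent a b → Adjacent b a
adjacent-sym (inj₁ ab) = inj₂ ab
adjacent-sym (inj₂ ba) = inj₁ ba

IsParent-unique : ∀ {a a′ b} → IsParent a b → IsParent a′ b → a ≡ a′
IsParent-unique {a} {a′} (_ , refl) (_ , e) = ∷ʳ-injectiveˡ a a′ e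

parent-∷ʳ : ∀ a k → parent (a ∷ʳ k) ≡ just a
parent-∷ʳ []          k = refl
parent-∷ʳ (x ∷ [])    k = refl
parent-∷ʳ (x ∷ y ∷ a) k rewrite parent-∷ʳ (y ∷ a) k = refl

parent≡just⇒IsParent : ∀ b {a} → parent b ≡ just a → IsParent a b
parent≡just⇒IsParent (x ∷ [])    refl = x , refl
parent≡just⇒IsParent (x ∷ y ∷ b) e with parent (y ∷ b) in e′
parent≡just⇒IsParent (x ∷ y ∷ b) refl | just c =
  map₂ (cong (x ∷_)) (parent≡just⇒IsParent (y ∷ b) e′)

just≡parent⇔IsParent : ∀ {a b} → (just a ≡ parent b) ⇔ IsParent a b
just≡parent⇔IsParent {a} {b} = mk⇔
  (parent≡just⇒IsParent b ∘ sym)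
  (λ { (k , refl) → sym (parent-∷ʳ a k) })

prefix-refl : ∀ a → Prefix a a
prefix-refl a = [] , sym (++-identityʳ a)

prefix-∷ʳ : ∀ {c a} k → Prefix c a → Prefix c (a ∷ʳ k)
prefix-∷ʳ {c} k (s , refl) = s ∷ʳ k , ++-assoc c s [ k ]

prefix-∷ʳ⁻ : ∀ {c a k} → Prefix c (a ∷ʳ k) → Prefix c a ⊎ c ≡ a ∷ʳ k
prefix-∷ʳ⁻ {c} {a} (s , e) with reverseView s
... | []          = inj₂ (trans (sym (++-identityʳ c)) (sym e))
... | s′ ∶ _ ∶ʳ m =
  inj₁ (s′ , ∷ʳ-injectiveˡ a (c ++ s′) (trans e (sym (++-assoc c s′ [ m ]))))

prefix-[] : ∀ {c} → Prefix c [] → c ≡ []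
prefix-[] {c} (s , e) = ++-conicalˡ c s (sym e)

∷ʳ-not-prefix : ∀ {a k} → ¬ Prefix (a ∷ʳ k) a
∷ʳ-not-prefix {a} {k} (s , e) with ++-identityʳ-unique a (trans e (∷ʳ-++ a k s))
... | ()

AncestorsIn : (Pos → Set) → Pos → Set
AncestorsIn V a = ∀ c → Prefix c a → V c

module _ {V : Pos → Set} where

  ancestorsIn-[] : V [] → AncestorsIn V []
  ancestorsIn-[] v c c⊑[] = subst V (sym (prefix-[] c⊑[])) v

  ancestorsIn-step : ∀ {a b} → AncestorsIn V a → Adjacent a b → V b → AncestorsIn V b
  ancestorsIn-step anc (inj₁ (k , refl)) vb c c⊑b with prefix-∷ʳ⁻ c⊑b
  ... | inj₁ c⊑a  = anc c c⊑a
  ... | inj₂ refl = vb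
  ancestorsIn-step anc (inj₂ (k , refl)) vb c c⊑b = anc c (prefix-∷ʳ k c⊑b)

module _ {A : Set} (t : Tree A) where

  dom-++ : ∀ a s → Dom t (a ++ s) → Dom t a
  dom-++ a []      d = subst (Dom t) (++-identityʳ a) d
  dom-++ a (k ∷ s) d =
    prefixClosed t a k (dom-++ (a ∷ʳ k) s (subst (Dom t) (sym (∷ʳ-++ a k s)) d))

  dom-prefix : ∀ {a b} → Prefix a b → Dom t b → Dom t a
  dom-prefix {a} (s , refl) = dom-++ a s

  module _ {f : Pos → Pos}
           (adjacent : ∀ z k → Dom t (z ∷ʳ k) → Adjacent (f z) (f (z ∷ʳ k)))
           {V : Pos → Set} where

    ancestorsIn-image⇔root : ∀ z → Dom t z → (∀ b → Prefix b z → V (f b)) →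
                             AncestorsIn V (f z) ⇔ AncestorsIn V (f [])
    ancestorsIn-image⇔root z = along (reverseView z)
      where
      along : ∀ {z} → Reverse z → Dom t z → (∀ b → Prefix b z → V (f b)) →
              AncestorsIn V (f z) ⇔ AncestorsIn V (f [])
      along []            _  _  = ⇔-id _
      along (y ∶ ys ∶ʳ k) dz vz = along ys dy vy ⇔-∘ mk⇔
          (λ anc → ancestorsIn-step anc (adjacent-sym edge) (vy y (prefix-refl y)))
          (λ anc → ancestorsIn-step anc edge (vz (y ∷ʳ k) (prefix-refl (y ∷ʳ k))))
        where
        dy = prefixClosed t y k dz
        edge = adjacent y k dz
        vy : ∀ b → Prefix b y → V (f b)
        vy b b⊑y = vz b (prefix-∷ʳ k b⊑y)

sim⇒adjacent : ∀ {A} (t u : Tree A) {r} → Sim t u r →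
               ∀ z k → Dom t (z ∷ʳ k) → Adjacent (r z) (r (z ∷ʳ k))
sim⇒adjacent _ _ sim z k d with sim z k d
... | down j , _ , e = inj₁ (j , just-injective e)
... | up     , _ , e = inj₂ (to just≡parent⇔IsParent e)

module _ {A : Set} (t u : Tree A) {r : Pos → Pos}
         (r-injective : ∀ a b → Dom t a → Dom t b → r a ≡ r b → a ≡ b)
         (sim : Sim t u r) {p : Pos} (dp : Dom t p) (root : r p ≡ []) where

  prefix-of-root⇒up : ∀ {z k} → Prefix (z ∷ʳ k) p → IsParent (r (z ∷ʳ k)) (r z)
  prefix-of-root⇒up (s , refl) = towards _ _ s dp root
    where
    towards : ∀ z k s → Dom t (z ∷ʳ k ++ s) → r (z ∷ʳ k ++ s) ≡ [] →
              IsParent (r (z ∷ʳ k)) (r z)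
    towards z k [] d rd with sim⇒adjacent t u sim z k (dom-++ t (z ∷ʳ k) [] d)
    ... | inj₂ upward = upward
    ... | inj₁ (j , downward)
      with () ← ++-conicalʳ (r z) [ j ]
                  (trans (sym downward) (trans (cong r (sym (++-identityʳ _))) rd))
    towards z k (m ∷ s) d rd with sim⇒adjacent t u sim z k (dom-++ t (z ∷ʳ k) (m ∷ s) d)
    ... | inj₂ upward   = upward
    ... | inj₁ downward =
      ⊥-elim (∷ʳ-not-prefix ([ m ] , r-injective _ _ dz dzkm (IsParent-unique downward ih)))
      where
      shift = ∷ʳ-++ (z ∷ʳ k) m s
      d′ = subst (Dom t) (sym shift) d
      ih = towards (z ∷ʳ k) m s d′ (trans (cong r shift) rd)
      dz = prefixClosed t z k (dom-++ t (z ∷ʳ k) (m ∷ s) d)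
      dzkm = dom-++ t (z ∷ʳ k ∷ʳ m) s d′

  module _ {q : Pos} (dq : Dom t q) where

    OnPaths : Pos → Set
    OnPaths c = ∃[ w ] ((Prefix w p ⊎ Prefix w q) × r w ≡ c)

    ancestorsIn-OnPaths : AncestorsIn OnPaths (r q)
    ancestorsIn-OnPaths = from (transport q dq on-q) (to (transport p dp on-p) at-p)
      where
      transport = ancestorsIn-image⇔root t (sim⇒adjacent t u sim)
      on-p : ∀ b → Prefix b p → OnPaths (r b)
      on-p b b⊑p = b , inj₁ b⊑p , refl
      on-q : ∀ b → Prefix b q → OnPaths (r b)
      on-q b b⊑q = b , inj₂ b⊑q , refl
      at-p : AncestorsIn OnPaths (r p)
      at-p = subst (AncestorsIn OnPaths) (sym root)
                   (ancestorsIn-[] (p , inj₁ (prefix-refl p) , root))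

    up⇒prefix-of-root : ∀ {d} → Dom t (q ∷ʳ d) → IsParent (r (q ∷ʳ d)) (r q) →
                        Prefix (q ∷ʳ d) p
    up⇒prefix-of-root {d} dqd (j , e) with ancestorsIn-OnPaths (r (q ∷ʳ d)) ([ j ] , e)
    ... | w , inj₁ w⊑p , rw =
      subst (λ x → Prefix x p) (r-injective w _ (dom-prefix t w⊑p dp) dqd rw) w⊑p
    ... | w , inj₂ w⊑q , rw =
      ⊥-elim (∷ʳ-not-prefix
        (subst (λ x → Prefix x q) (r-injective w _ (dom-prefix t w⊑q dq) dqd rw) w⊑q))

lemma6 : {A : Set} (t u : Tree A) (r : Pos → Pos) →
    IsDomBijection t u r → Sim t u r →
    (p : Pos) → Dom t p → r p ≡ [] →
    (q : Pos) (d : ℕ) → Dom t q → Dom t (q ++ [ d ]) →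
    (just (r (q ++ [ d ])) ≡ r q · up) ⇔ Prefix (q ++ [ d ]) p
lemma6 t u r (_ , r-injective , _) sim p dp root q d dq dqd =
  mk⇔ (up⇒prefix-of-root t u r-injective sim dp root dq dqd ∘ to just≡parent⇔IsParent)
      (from just≡parent⇔IsParent ∘ prefix-of-root⇒up t u r-injective sim dp root)
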